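{- Let $(G,D)$ be a standard pair with $|D|=1$. Then there exists a strong orientation $\overrightarrow{G}$ of $G$ such that $diam(\overrightarrow{G})\le 4$ and $sdiam(\overrightarrow{G})\le 6$.
   Context: Graphs are finite, simple, undirected and connected. A graph is bridgeless if it has no edge whose removal disconnects it. A vertex $v$ is associated with an isolated triangle if there exist vertices $v_1,v_2$ with $d_G(v_1)=d_G(v_2)=2$ such that $vv_1v_2$ is a triangle. A pair $(G,D)$ is standard if $G$ is bridgeless, $D\subseteq V(G)$ is an independent dominating set of $G$, every vertex of $V(G)\setminus D$ is adjacent to exactly one vertex of $D$, and every vertex of $D$ is associated with an isolated triangle. For a strong orientation $\overrightarrow{G}$, $\partial(u,v)$ is the length of a shortest directed $u$–$v$ path, $diam(\overrightarrow{G})=\max_{u,v}\max\{\partial(u,v),\partial(v,u)\}$; the strong distance $sd(u,v)$ is the minimum number of arcs of a strongly connected subdigraph containing $u$ and $v$, and $sdiam(\overrightarrow{G})=\max_{u,v}sd(u,v)$. -}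

module Defs where

open import Data.Nat using (ℕ; zero; suc; _≤_)
open import Data.Bool using (Bool; true; false)
open import Data.Fin using (Fin)
open import Data.Fin.Subset using (Subset; _∈_; _∉_; ∣_∣)
open import Data.Vec using (tabulate; sum)
open import Data.Product using (Σ; ∃; _×_; _,_)
open import Data.Sum using (_⊎_)
open import Relation.Binary.PropositionalEquality using (_≡_)
open import Relation.Nullary using (¬_)

record Graph (n : ℕ) : Set where
  field
    adj    : Fin n → Fin n → Bool
    sym    : ∀ i j → adj i j ≡ adj j i
    irrefl : ∀ i → adj i i ≡ false
open Graph public

Edge : ∀ {n} → Graph n → Fin n → Fin n → Set
Edge G i j = adj G i j ≡ true

data Walk {n : ℕ} (R : Fin n → Fin n → Set) : Fin n → Fin n → ℕ → Set where
  nil  : ∀ {x} → Walk R x x 0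
  cons : ∀ {x y z k} → R x y → Walk R y z k → Walk R x z (suc k)

Reach : ∀ {n} → (Fin n → Fin n → Set) → Fin n → Fin n → Set
Reach R x y = ∃ λ k → Walk R x y k

Connected : ∀ {n} → Graph n → Set
Connected G = ∀ x y → Reach (Edge G) x y

EdgeMinus : ∀ {n} → Graph n → Fin n → Fin n → Fin n → Fin n → Set
EdgeMinus G x y i j = Edge G i j × ¬ ((i ≡ x × j ≡ y) ⊎ (i ≡ y × j ≡ x))

Bridgeless : ∀ {n} → Graph n → Set
Bridgeless G = ∀ x y → Edge G x y → ∀ u w → Reach (EdgeMinus G x y) u w

deg : ∀ {n} → Graph n → Fin n → ℕ
deg G v = ∣ tabulate (adj G v) ∣

Independent : ∀ {n} → Graph n → Subset n → Set
Independent G D = ∀ x y → x ∈ D → y ∈ D → ¬ Edge G x y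

Dominating : ∀ {n} → Graph n → Subset n → Set
Dominating G D = ∀ x → x ∉ D → ∃ λ d → d ∈ D × Edge G x d

UniqueDomination : ∀ {n} → Graph n → Subset n → Set
UniqueDomination G D = ∀ x → x ∉ D →
  (∃ λ d → d ∈ D × Edge G x d) ×
  (∀ d d' → d ∈ D → d' ∈ D → Edge G x d → Edge G x d' → d ≡ d')

AssocIsolatedTriangle : ∀ {n} → Graph n → Fin n → Set
AssocIsolatedTriangle G v = Σ _ λ v₁ → Σ _ λ v₂ →
  deg G v₁ ≡ 2 × deg G v₂ ≡ 2 × Edge G v v₁ × Edge G v₁ v₂ × Edge G v v₂

Standard : ∀ {n} → Graph n → Subset n → Set
Standard G D =
  Connected G × Bridgeless G × Independent G D × Dominating G D ×
  UniqueDomination G D × (∀ v → v ∈ D → AssocIsolatedTriangle G v)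

record Orientation {n : ℕ} (G : Graph n) : Set where
  field
    arc      : Fin n → Fin n → Bool
    arc-edge : ∀ i j → arc i j ≡ true → Edge G i j
    edge-arc : ∀ i j → Edge G i j → arc i j ≡ true ⊎ arc j i ≡ true
    antisym  : ∀ i j → arc i j ≡ true → ¬ (arc j i ≡ true)
open Orientation public

Arc : ∀ {n} {G : Graph n} → Orientation G → Fin n → Fin n → Set
Arc O i j = arc O i j ≡ true

Strong : ∀ {n} {G : Graph n} → Orientation G → Set
Strong O = ∀ x y → Reach (Arc O) x y

DistLe : ∀ {n} {G : Graph n} → Orientation G → Fin n → Fin n → ℕ → Set
DistLe O x y k = ∃ λ l → l ≤ k × Walk (Arc O) x y l

DiamLe : ∀ {n} {G : Graph n} → Orientation G → ℕ → Set
DiamLe O k = ∀ x y → DistLe O x y k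

record SubDigraph {n : ℕ} {G : Graph n} (O : Orientation G) : Set where
  field
    vs      : Subset n
    as      : Fin n → Fin n → Bool
    as-arc  : ∀ i j → as i j ≡ true → Arc O i j
    as-srcV : ∀ i j → as i j ≡ true → i ∈ vs
    as-tgtV : ∀ i j → as i j ≡ true → j ∈ vs
open SubDigraph public

SArc : ∀ {n} {G : Graph n} {O : Orientation G} → SubDigraph O → Fin n → Fin n → Set
SArc H i j = as H i j ≡ true

StronglyConnectedSub : ∀ {n} {G : Graph n} {O : Orientation G} → SubDigraph O → Set
StronglyConnectedSub H = ∀ x y → x ∈ vs H → y ∈ vs H → Reach (SArc H) x y

arcCount : ∀ {n} {G : Graph n} {O : Orientation G} → SubDigraph O → ℕ
arcCount H = sum (tabulate λ i → ∣ tabulate (as H i) ∣)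

StrongDistLe : ∀ {n} {G : Graph n} → Orientation G → Fin n → Fin n → ℕ → Set
StrongDistLe O x y k = Σ (SubDigraph O) λ H →
  StronglyConnectedSub H × x ∈ vs H × y ∈ vs H × arcCount H ≤ k

SDiamLe : ∀ {n} {G : Graph n} → Orientation G → ℕ → Set
SDiamLe O k = ∀ x y → StrongDistLe O x y k

module Submission where

-- With D = {v}, domination makes v adjacent to every other vertex, and bridgelessness
-- (the edge xv is not a bridge) gives every x ≠ v a neighbour other than v.  Take a
-- maximal independent set I of G - v and put v on level 0, I on level 1 and the
-- remaining vertices on level 2; orient every edge one level up modulo 3, and edges
-- inside a level by vertex index.  A vertex x of I has a neighbour w ≠ v, which lies
-- outside I, and a vertex x ∉ I has a neighbour in I by maximality, so every vertex
-- lies on a directed triangle v → a → b → v.  Going through v gives ∂(x,y) ≤ 2 + 2,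
-- and the union of the triangles through x and through y is a strongly connected
-- subdigraph with at most 3 + 3 arcs.

open import Defs hiding (sym)
open import Data.Bool using (Bool; true; false; _∧_; _∨_)
open import Data.Bool.Properties using () renaming (_≟_ to _≟ᵇ_)
open import Data.Fin using (Fin; zero; suc; _<_)
open import Data.Fin.Properties using (_≟_; <-cmp; <-asym; any?; _<?_; suc-injective)
open import Data.Fin.Subset using (Subset; _∈_; _∉_; _⊆_; ∣_∣; ⊥; ⁅_⁆; _∪_; inside; outside)
open import Data.Fin.Subset.Properties
  using (_∈?_; ∉⊥; x∈⁅x⁆; x∈⁅y⁆⇒x≡y; x∈p∪q⁺; x∈p∪q⁻; q⊆p∪q)
open import Data.List using (List; []; _∷_; allFin)
open import Data.List.Membership.Propositional using () renaming (_∈_ to _∈ˡ_)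
open import Data.List.Membership.Propositional.Properties using (∈-allFin)
open import Data.List.Relation.Unary.Any using (here; there)
open import Data.Nat using (ℕ; zero; suc; _+_; _≤_; z≤n; s≤s)
open import Data.Nat.Properties
  using (≤-refl; ≤-trans; ≤-reflexive; +-mono-≤; +-monoʳ-≤; +-suc; +-identityʳ; n≤1+n; +-commutativeSemigroup)
import Data.Nat.Properties as ℕ
open import Algebra.Properties.CommutativeSemigroup +-commutativeSemigroup using (interchange)
open import Data.Product using (Σ; ∃; _×_; _,_; proj₁; proj₂)
open import Data.Sum as Sum using (_⊎_; inj₁; inj₂)
open import Data.Vec using (_∷_; tabulate; sum; here; there)
open import Function using (_∘_)
open import Relation.Binary using (tri<; tri≈; tri>)
open import Relation.Binary.PropositionalEquality
open import Relation.Nullary using (¬_; Dec; yes; no; does; contradiction)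
open import Relation.Nullary.Decidable using (dec-true; dec-false; _×-dec_; _⊎-dec_)

does⇒witness : ∀ {A : Set} (a? : Dec A) → does a? ≡ true → A
does⇒witness (yes a) _ = a
does⇒witness (no _) ()

∉-∣0∣ : ∀ {n} {p : Subset n} {x} → ∣ p ∣ ≡ 0 → x ∉ p
∉-∣0∣ {p = inside ∷ p} () _
∉-∣0∣ {p = outside ∷ p} ∣p∣≡0 (there x∈p) = ∉-∣0∣ ∣p∣≡0 x∈p

∣p∣≡1⇒singleton : ∀ {n} (p : Subset n) → ∣ p ∣ ≡ 1 → ∃ λ v → v ∈ p × ∀ x → x ∈ p → x ≡ v
∣p∣≡1⇒singleton (inside ∷ p) ∣p∣≡1 = zero , here , only-zero
  where
  only-zero : ∀ x → x ∈ inside ∷ p → x ≡ zero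
  only-zero zero _ = refl
  only-zero (suc x) (there x∈p) = contradiction x∈p (∉-∣0∣ (ℕ.suc-injective ∣p∣≡1))
∣p∣≡1⇒singleton (outside ∷ p) ∣p∣≡1 with ∣p∣≡1⇒singleton p ∣p∣≡1
... | v , v∈p , unique = suc v , there v∈p , only-suc-v
  where
  only-suc-v : ∀ x → x ∈ outside ∷ p → x ≡ suc v
  only-suc-v (suc x) (there x∈p) = cong suc (unique x x∈p)

module _ {n} (G : Graph n) where

  edge? : ∀ i j → Dec (Edge G i j)
  edge? i j = adj G i j ≟ᵇ true

  edge-sym : ∀ {i j} → Edge G i j → Edge G j i
  edge-sym {i} {j} e = trans (Graph.sym G j i) e

  edge⇒≢ : ∀ {i j} → Edge G i j → i ≢ j
  edge⇒≢ {i} e refl = contradiction (trans (sym e) (irrefl G i)) λ ()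

bridgeless⇒other-neighbour : ∀ {n} {G : Graph n} {x y} → Bridgeless G → Edge G x y →
  ∃ λ w → w ≢ y × Edge G x w
bridgeless⇒other-neighbour {G = G} {x} {y} bridgeless x—y with bridgeless x y x—y x y
... | _ , nil = contradiction refl (edge⇒≢ G x—y)
... | _ , cons (x—w , not-xy) _ = _ , (λ w≡y → not-xy (inj₁ (refl , w≡y))) , x—w

∣tabulate-false∣ : ∀ n → ∣ tabulate {n = n} (λ _ → false) ∣ ≡ 0
∣tabulate-false∣ zero = refl
∣tabulate-false∣ (suc n) = ∣tabulate-false∣ n

∣tabulate-≟∣ : ∀ {n} (b : Fin n) → ∣ tabulate (λ j → does (j ≟ b)) ∣ ≡ 1
∣tabulate-≟∣ {suc n} zero = cong suc (∣tabulate-false∣ n)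
∣tabulate-≟∣ (suc b) = ∣tabulate-≟∣ b

∣tabulate-∨∣≤ : ∀ {n} (f g : Fin n → Bool) →
  ∣ tabulate (λ j → f j ∨ g j) ∣ ≤ ∣ tabulate f ∣ + ∣ tabulate g ∣
∣tabulate-∨∣≤ {zero} f g = z≤n
∣tabulate-∨∣≤ {suc n} f g with f zero | g zero | ∣tabulate-∨∣≤ (f ∘ suc) (g ∘ suc)
... | true  | true  | ih = s≤s (≤-trans ih (+-monoʳ-≤ _ (n≤1+n _)))
... | true  | false | ih = s≤s ih
... | false | true  | ih = ≤-trans (s≤s ih) (≤-reflexive (sym (+-suc ∣ tabulate (f ∘ suc) ∣ _)))
... | false | false | ih = ih

sum-tabulate-mono : ∀ {n} {f g : Fin n → ℕ} → (∀ i → f i ≤ g i) →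
  sum (tabulate f) ≤ sum (tabulate g)
sum-tabulate-mono {zero} _ = z≤n
sum-tabulate-mono {suc n} f≤g = +-mono-≤ (f≤g zero) (sum-tabulate-mono (f≤g ∘ suc))

sum-tabulate-+ : ∀ {n} (f g : Fin n → ℕ) →
  sum (tabulate (λ i → f i + g i)) ≡ sum (tabulate f) + sum (tabulate g)
sum-tabulate-+ {zero} f g = refl
sum-tabulate-+ {suc n} f g =
  trans (cong (f zero + g zero +_) (sum-tabulate-+ (f ∘ suc) (g ∘ suc)))
        (interchange (f zero) (g zero) (sum (tabulate (f ∘ suc))) (sum (tabulate (g ∘ suc))))

sum-tabulate-0 : ∀ {n} (f : Fin n → ℕ) → (∀ i → f i ≡ 0) → sum (tabulate f) ≡ 0
sum-tabulate-0 {zero} f _ = refl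
sum-tabulate-0 {suc n} f f≡0 rewrite f≡0 zero = sum-tabulate-0 (f ∘ suc) (f≡0 ∘ suc)

sum-tabulate-single : ∀ {n} (f : Fin n → ℕ) a → (∀ i → i ≢ a → f i ≡ 0) → sum (tabulate f) ≡ f a
sum-tabulate-single f zero off-a =
  trans (cong (f zero +_) (sum-tabulate-0 (f ∘ suc) (λ i → off-a (suc i) λ ()))) (+-identityʳ _)
sum-tabulate-single f (suc a) off-a rewrite off-a zero (λ ()) =
  sum-tabulate-single (f ∘ suc) a (λ i i≢a → off-a (suc i) (i≢a ∘ suc-injective))

-- arcCount H unfolds to size (as H).
size : ∀ {n} → (Fin n → Fin n → Bool) → ℕ
size R = sum (tabulate λ i → ∣ tabulate (R i) ∣)

size-∨ : ∀ {n} {R S : Fin n → Fin n → Bool} {k m} →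
  size R ≤ k → size S ≤ m → size (λ i j → R i j ∨ S i j) ≤ k + m
size-∨ {R = R} {S} {k} {m} R≤k S≤m = begin
  size (λ i j → R i j ∨ S i j)
    ≤⟨ sum-tabulate-mono (λ i → ∣tabulate-∨∣≤ (R i) (S i)) ⟩
  sum (tabulate λ i → ∣ tabulate (R i) ∣ + ∣ tabulate (S i) ∣)
    ≡⟨ sum-tabulate-+ (λ i → ∣ tabulate (R i) ∣) (λ i → ∣ tabulate (S i) ∣) ⟩
  size R + size S
    ≤⟨ +-mono-≤ R≤k S≤m ⟩
  k + m ∎
  where open ℕ.≤-Reasoning

single : ∀ {n} → Fin n → Fin n → Fin n → Fin n → Bool
single a b i j = does (i ≟ a) ∧ does (j ≟ b)

size-single : ∀ {n} (a b : Fin n) → size (single a b) ≡ 1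
size-single {n} a b = begin
  size (single a b)
    ≡⟨ sum-tabulate-single _ a off-row ⟩
  ∣ tabulate (λ j → does (a ≟ a) ∧ does (j ≟ b)) ∣
    ≡⟨ cong (λ c → ∣ tabulate (λ j → c ∧ does (j ≟ b)) ∣) (dec-true (a ≟ a) refl) ⟩
  ∣ tabulate (λ j → does (j ≟ b)) ∣
    ≡⟨ ∣tabulate-≟∣ b ⟩
  1 ∎
  where
  open ≡-Reasoning
  off-row : ∀ i → i ≢ a → ∣ tabulate (λ j → does (i ≟ a) ∧ does (j ≟ b)) ∣ ≡ 0
  off-row i i≢a rewrite dec-false (i ≟ a) i≢a = ∣tabulate-false∣ n

WalkLe : ∀ {n} → (Fin n → Fin n → Set) → Fin n → Fin n → ℕ → Set
WalkLe R x y k = ∃ λ l → l ≤ k × Walk R x y l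

walk-++ : ∀ {n} {R : Fin n → Fin n → Set} {x y z k m} →
  Walk R x y k → Walk R y z m → Walk R x z (k + m)
walk-++ nil q = q
walk-++ (cons r p) q = cons r (walk-++ p q)

walkLe-++ : ∀ {n} {R : Fin n → Fin n → Set} {x y z k m} →
  WalkLe R x y k → WalkLe R y z m → WalkLe R x z (k + m)
walkLe-++ (l₁ , l₁≤k , p) (l₂ , l₂≤m , q) = l₁ + l₂ , +-mono-≤ l₁≤k l₂≤m , walk-++ p q

record Triangle {n} (R : Fin n → Fin n → Set) (h : Fin n) : Set where
  constructor triangle
  field
    {a b} : Fin n
    h→a : R h a
    a→b : R a b
    b→h : R b h

module _ {n} {R : Fin n → Fin n → Set} {h : Fin n} where
  open Triangle

  _∈ᵗ_ : Fin n → Triangle R h → Set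
  x ∈ᵗ t = x ≡ h ⊎ x ≡ a t ⊎ x ≡ b t

  TriangleArc : Triangle R h → Fin n → Fin n → Set
  TriangleArc t i j = (i ≡ h × j ≡ a t) ⊎ (i ≡ a t × j ≡ b t) ⊎ (i ≡ b t × j ≡ h)

  triangleArc? : ∀ t i j → Dec (TriangleArc t i j)
  triangleArc? t i j =
    (i ≟ h ×-dec j ≟ a t) ⊎-dec (i ≟ a t ×-dec j ≟ b t) ⊎-dec (i ≟ b t ×-dec j ≟ h)

  size-triangleArc : ∀ t → size (λ i j → does (triangleArc? t i j)) ≤ 3
  size-triangleArc t =
    size-∨ {R = single h (a t)} (≤-reflexive (size-single h (a t)))
      (size-∨ {R = single (a t) (b t)} {S = single (b t) h}
        (≤-reflexive (size-single (a t) (b t))) (≤-reflexive (size-single (b t) h)))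

  triangleArc⇒R : ∀ t {i j} → TriangleArc t i j → R i j
  triangleArc⇒R t (inj₁ (refl , refl)) = h→a t
  triangleArc⇒R t (inj₂ (inj₁ (refl , refl))) = a→b t
  triangleArc⇒R t (inj₂ (inj₂ (refl , refl))) = b→h t

  triangleArc-source : ∀ t {i j} → TriangleArc t i j → i ∈ᵗ t
  triangleArc-source t (inj₁ (i≡h , _)) = inj₁ i≡h
  triangleArc-source t (inj₂ (inj₁ (i≡a , _))) = inj₂ (inj₁ i≡a)
  triangleArc-source t (inj₂ (inj₂ (i≡b , _))) = inj₂ (inj₂ i≡b)

  triangleArc-target : ∀ t {i j} → TriangleArc t i j → j ∈ᵗ t
  triangleArc-target t (inj₁ (_ , j≡a)) = inj₂ (inj₁ j≡a)
  triangleArc-target t (inj₂ (inj₁ (_ , j≡b))) = inj₂ (inj₂ j≡b)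
  triangleArc-target t (inj₂ (inj₂ (_ , j≡h))) = inj₁ j≡h

  mapTriangle : ∀ {S : Fin n → Fin n → Set} (t : Triangle R h) →
    (∀ {i j} → TriangleArc t i j → S i j) → Triangle S h
  mapTriangle t arcs =
    triangle (arcs (inj₁ (refl , refl))) (arcs (inj₂ (inj₁ (refl , refl)))) (arcs (inj₂ (inj₂ (refl , refl))))

  vertices : Triangle R h → Subset n
  vertices t = ⁅ h ⁆ ∪ ⁅ a t ⁆ ∪ ⁅ b t ⁆

  ∈vertices⁺ : ∀ t {x} → x ∈ᵗ t → x ∈ vertices t
  ∈vertices⁺ t (inj₁ refl) = x∈p∪q⁺ (inj₁ (x∈⁅x⁆ _))
  ∈vertices⁺ t (inj₂ (inj₁ refl)) = x∈p∪q⁺ (inj₂ (x∈p∪q⁺ (inj₁ (x∈⁅x⁆ _))))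
  ∈vertices⁺ t (inj₂ (inj₂ refl)) = x∈p∪q⁺ (inj₂ (x∈p∪q⁺ (inj₂ (x∈⁅x⁆ _))))

  ∈vertices⁻ : ∀ t {x} → x ∈ vertices t → x ∈ᵗ t
  ∈vertices⁻ t x∈t with x∈p∪q⁻ ⁅ h ⁆ _ x∈t
  ... | inj₁ x∈h = inj₁ (x∈⁅y⁆⇒x≡y h x∈h)
  ... | inj₂ x∈ab with x∈p∪q⁻ ⁅ a t ⁆ ⁅ b t ⁆ x∈ab
  ...   | inj₁ x∈a = inj₂ (inj₁ (x∈⁅y⁆⇒x≡y (a t) x∈a))
  ...   | inj₂ x∈b = inj₂ (inj₂ (x∈⁅y⁆⇒x≡y (b t) x∈b))

  walkToHub : ∀ (t : Triangle R h) {x} → x ∈ᵗ t → WalkLe R x h 2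
  walkToHub t (inj₁ refl) = 0 , z≤n , nil
  walkToHub t (inj₂ (inj₁ refl)) = 2 , ≤-refl , cons (a→b t) (cons (b→h t) nil)
  walkToHub t (inj₂ (inj₂ refl)) = 1 , s≤s z≤n , cons (b→h t) nil

  walkFromHub : ∀ (t : Triangle R h) {x} → x ∈ᵗ t → WalkLe R h x 2
  walkFromHub t (inj₁ refl) = 0 , z≤n , nil
  walkFromHub t (inj₂ (inj₁ refl)) = 1 , s≤s z≤n , cons (h→a t) nil
  walkFromHub t (inj₂ (inj₂ refl)) = 2 , ≤-refl , cons (h→a t) (cons (a→b t) nil)

diam⇒strong : ∀ {n} {G : Graph n} {O : Orientation G} {k} → DiamLe O k → Strong O
diam⇒strong diam x y = let l , _ , p = diam x y in l , p

record TriangleCover {n} {G : Graph n} (O : Orientation G) (h : Fin n) : Set where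
  field
    triangleAt : ∀ x → Σ (Triangle (Arc O) h) (x ∈ᵗ_)

module _ {n} {G : Graph n} {O : Orientation G} {h : Fin n} where
  open TriangleCover

  cover⇒diam≤4 : TriangleCover O h → DiamLe O 4
  cover⇒diam≤4 cover x y =
    let tx , x∈tx = triangleAt cover x
        ty , y∈ty = triangleAt cover y
    in walkLe-++ (walkToHub tx x∈tx) (walkFromHub ty y∈ty)

  module TwoTriangles (t₁ t₂ : Triangle (Arc O) h) where

    arc? : ∀ i j → Dec (TriangleArc t₁ i j ⊎ TriangleArc t₂ i j)
    arc? i j = triangleArc? t₁ i j ⊎-dec triangleArc? t₂ i j

    V : Subset n
    V = vertices t₁ ∪ vertices t₂

    ∈V⁺ : ∀ {x} → x ∈ᵗ t₁ ⊎ x ∈ᵗ t₂ → x ∈ V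
    ∈V⁺ (inj₁ x∈t₁) = x∈p∪q⁺ (inj₁ (∈vertices⁺ t₁ x∈t₁))
    ∈V⁺ (inj₂ x∈t₂) = x∈p∪q⁺ (inj₂ (∈vertices⁺ t₂ x∈t₂))

    H : SubDigraph O
    H = record
      { vs = V
      ; as = λ i j → does (arc? i j)
      ; as-arc = λ i j → Sum.[ triangleArc⇒R t₁ , triangleArc⇒R t₂ ] ∘ does⇒witness (arc? i j)
      ; as-srcV = λ i j →
          ∈V⁺ ∘ Sum.map (triangleArc-source t₁) (triangleArc-source t₂) ∘ does⇒witness (arc? i j)
      ; as-tgtV = λ i j →
          ∈V⁺ ∘ Sum.map (triangleArc-target t₁) (triangleArc-target t₂) ∘ does⇒witness (arc? i j)
      }

    t₁ᴴ t₂ᴴ : Triangle (SArc H) h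
    t₁ᴴ = mapTriangle t₁ (dec-true (arc? _ _) ∘ inj₁)
    t₂ᴴ = mapTriangle t₂ (dec-true (arc? _ _) ∘ inj₂)

    walkToHubᴴ : ∀ {x} → x ∈ vs H → WalkLe (SArc H) x h 2
    walkToHubᴴ x∈H with x∈p∪q⁻ (vertices t₁) _ x∈H
    ... | inj₁ x∈t₁ = walkToHub t₁ᴴ (∈vertices⁻ t₁ x∈t₁)
    ... | inj₂ x∈t₂ = walkToHub t₂ᴴ (∈vertices⁻ t₂ x∈t₂)

    walkFromHubᴴ : ∀ {x} → x ∈ vs H → WalkLe (SArc H) h x 2
    walkFromHubᴴ x∈H with x∈p∪q⁻ (vertices t₁) _ x∈H
    ... | inj₁ x∈t₁ = walkFromHub t₁ᴴ (∈vertices⁻ t₁ x∈t₁)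
    ... | inj₂ x∈t₂ = walkFromHub t₂ᴴ (∈vertices⁻ t₂ x∈t₂)

    H-strong : StronglyConnectedSub H
    H-strong x y x∈H y∈H =
      let l , _ , p = walkLe-++ (walkToHubᴴ x∈H) (walkFromHubᴴ y∈H) in l , p

    H-arcCount : arcCount H ≤ 6
    H-arcCount =
      size-∨ {R = λ i j → does (triangleArc? t₁ i j)} (size-triangleArc t₁) (size-triangleArc t₂)

  cover⇒sdiam≤6 : TriangleCover O h → SDiamLe O 6
  cover⇒sdiam≤6 cover x y =
    let tx , x∈tx = triangleAt cover x
        ty , y∈ty = triangleAt cover y
        open TwoTriangles tx ty
    in H , H-strong , ∈V⁺ (inj₁ x∈tx) , ∈V⁺ (inj₂ y∈ty) , H-arcCount

next : Fin 3 → Fin 3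
next zero = suc zero
next (suc zero) = suc (suc zero)
next (suc (suc zero)) = zero

next-irrefl : ∀ c → next c ≢ c
next-irrefl zero ()
next-irrefl (suc zero) ()
next-irrefl (suc (suc zero)) ()

next²-irrefl : ∀ c → next (next c) ≢ c
next²-irrefl zero ()
next²-irrefl (suc zero) ()
next²-irrefl (suc (suc zero)) ()

next-total : ∀ c d → c ≢ d → d ≡ next c ⊎ c ≡ next d
next-total zero (suc zero) _ = inj₁ refl
next-total zero (suc (suc zero)) _ = inj₂ refl
next-total (suc zero) zero _ = inj₂ refl
next-total (suc zero) (suc (suc zero)) _ = inj₁ refl
next-total (suc (suc zero)) zero _ = inj₁ refl
next-total (suc (suc zero)) (suc zero) _ = inj₂ refl
next-total zero zero c≢c = contradiction refl c≢c
next-total (suc zero) (suc zero) c≢c = contradiction refl c≢c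
next-total (suc (suc zero)) (suc (suc zero)) c≢c = contradiction refl c≢c

module CyclicOrientation {n} (G : Graph n) (level : Fin n → Fin 3) where

  Forward : Fin n → Fin n → Set
  Forward i j = level j ≡ next (level i) ⊎ level i ≡ level j × i < j

  forward? : ∀ i j → Dec (Forward i j)
  forward? i j = level j ≟ next (level i) ⊎-dec (level i ≟ level j ×-dec i <? j)

  forward-asym : ∀ {i j} → Forward i j → ¬ Forward j i
  forward-asym {i} (inj₁ up) (inj₁ up′) = next²-irrefl (level i) (sym (trans up′ (cong next up)))
  forward-asym {i} (inj₁ up) (inj₂ (same , _)) = next-irrefl (level i) (trans (sym up) same)
  forward-asym {j = j} (inj₂ (same , _)) (inj₁ up) = next-irrefl (level j) (trans (sym up) same)
  forward-asym (inj₂ (_ , i<j)) (inj₂ (_ , j<i)) = <-asym i<j j<i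

  forward-total : ∀ {i j} → i ≢ j → Forward i j ⊎ Forward j i
  forward-total {i} {j} i≢j with level i ≟ level j
  ... | no differ = Sum.map inj₁ inj₁ (next-total (level i) (level j) differ)
  ... | yes same with <-cmp i j
  ...   | tri< i<j _ _ = inj₁ (inj₂ (same , i<j))
  ...   | tri≈ _ i≡j _ = contradiction i≡j i≢j
  ...   | tri> _ _ j<i = inj₂ (inj₂ (sym same , j<i))

  arc? : ∀ i j → Dec (Edge G i j × Forward i j)
  arc? i j = edge? G i j ×-dec forward? i j

  orientation : Orientation G
  orientation = record
    { arc = λ i j → does (arc? i j)
    ; arc-edge = λ i j → proj₁ ∘ does⇒witness (arc? i j)
    ; edge-arc = edge⇒arc
    ; antisym = λ i j p q →
        forward-asym (proj₂ (does⇒witness (arc? i j) p)) (proj₂ (does⇒witness (arc? j i) q))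
    }
    where
    edge⇒arc : ∀ i j → Edge G i j → does (arc? i j) ≡ true ⊎ does (arc? j i) ≡ true
    edge⇒arc i j e with forward-total (edge⇒≢ G e)
    ... | inj₁ fwd = inj₁ (dec-true (arc? i j) (e , fwd))
    ... | inj₂ bwd = inj₂ (dec-true (arc? j i) (edge-sym G e , bwd))

  arc-up : ∀ {i j} → Edge G i j → level j ≡ next (level i) → Arc orientation i j
  arc-up e up = dec-true (arc? _ _) (e , inj₁ up)

module GreedyIndependentSet {n} (G : Graph n) (v : Fin n) where

  Blocked : Subset n → Fin n → Set
  Blocked I x = x ≡ v ⊎ ∃ λ y → y ∈ I × Edge G x y

  blocked? : ∀ I x → Dec (Blocked I x)
  blocked? I x = x ≟ v ⊎-dec any? λ y → y ∈? I ×-dec edge? G x y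

  insert : Subset n → Fin n → Subset n
  insert I x with blocked? I x
  ... | yes _ = I
  ... | no _ = ⁅ x ⁆ ∪ I

  greedy : List (Fin n) → Subset n
  greedy [] = ⊥
  greedy (x ∷ xs) = insert (greedy xs) x

  Valid : Subset n → Set
  Valid I = v ∉ I × Independent G I

  Settled : Subset n → Fin n → Set
  Settled I x = x ∈ I ⊎ Blocked I x

  settled-mono : ∀ {I J x} → I ⊆ J → Settled I x → Settled J x
  settled-mono I⊆J (inj₁ x∈I) = inj₁ (I⊆J x∈I)
  settled-mono I⊆J (inj₂ (inj₁ x≡v)) = inj₂ (inj₁ x≡v)
  settled-mono I⊆J (inj₂ (inj₂ (y , y∈I , x—y))) = inj₂ (inj₂ (y , I⊆J y∈I , x—y))

  insert-⊇ : ∀ I x → I ⊆ insert I x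
  insert-⊇ I x with blocked? I x
  ... | yes _ = λ y∈I → y∈I
  ... | no _ = q⊆p∪q ⁅ x ⁆ I

  insert-settles : ∀ I x → Settled (insert I x) x
  insert-settles I x with blocked? I x
  ... | yes blocked = inj₂ blocked
  ... | no _ = inj₁ (x∈p∪q⁺ (inj₁ (x∈⁅x⁆ x)))

  insert-valid : ∀ I x → Valid I → Valid (insert I x)
  insert-valid I x valid with blocked? I x
  ... | yes _ = valid
  ... | no free = v∉ , independent
    where
    v∉ : v ∉ ⁅ x ⁆ ∪ I
    v∉ v∈ with x∈p∪q⁻ ⁅ x ⁆ I v∈
    ... | inj₁ v∈x = free (inj₁ (sym (x∈⁅y⁆⇒x≡y x v∈x)))
    ... | inj₂ v∈I = proj₁ valid v∈I
    independent : Independent G (⁅ x ⁆ ∪ I)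
    independent p q p∈ q∈ p—q with x∈p∪q⁻ ⁅ x ⁆ I p∈ | x∈p∪q⁻ ⁅ x ⁆ I q∈
    ... | inj₁ p∈x | inj₁ q∈x =
      edge⇒≢ G p—q (trans (x∈⁅y⁆⇒x≡y x p∈x) (sym (x∈⁅y⁆⇒x≡y x q∈x)))
    ... | inj₁ p∈x | inj₂ q∈I =
      free (inj₂ (q , q∈I , subst (λ z → Edge G z q) (x∈⁅y⁆⇒x≡y x p∈x) p—q))
    ... | inj₂ p∈I | inj₁ q∈x =
      free (inj₂ (p , p∈I , subst (λ z → Edge G z p) (x∈⁅y⁆⇒x≡y x q∈x) (edge-sym G p—q)))
    ... | inj₂ p∈I | inj₂ q∈I = proj₂ valid p q p∈I q∈I p—q

  greedy-valid : ∀ xs → Valid (greedy xs)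
  greedy-valid [] = ∉⊥ , λ _ _ x∈⊥ _ → contradiction x∈⊥ ∉⊥
  greedy-valid (x ∷ xs) = insert-valid (greedy xs) x (greedy-valid xs)

  greedy-settles : ∀ xs {x} → x ∈ˡ xs → Settled (greedy xs) x
  greedy-settles (x ∷ xs) (here refl) = insert-settles (greedy xs) x
  greedy-settles (y ∷ xs) (there x∈xs) =
    settled-mono (insert-⊇ (greedy xs) y) (greedy-settles xs x∈xs)

  I : Subset n
  I = greedy (allFin n)

  v∉I : v ∉ I
  v∉I = proj₁ (greedy-valid (allFin n))

  I-independent : Independent G I
  I-independent = proj₂ (greedy-valid (allFin n))

  I-maximal : ∀ x → x ≢ v → x ∉ I → ∃ λ y → y ∈ I × Edge G x y
  I-maximal x x≢v x∉I with greedy-settles (allFin n) (∈-allFin x)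
  ... | inj₁ x∈I = contradiction x∈I x∉I
  ... | inj₂ (inj₁ x≡v) = contradiction x≡v x≢v
  ... | inj₂ (inj₂ neighbour) = neighbour

module UniversalVertex {n} (G : Graph n) (v : Fin n)
  (universal : ∀ x → x ≢ v → Edge G x v)
  (neighbour : ∀ x → x ≢ v → ∃ λ w → w ≢ v × Edge G x w) where

  open GreedyIndependentSet G v

  level : Fin n → Fin 3
  level x with x ≟ v | x ∈? I
  ... | yes _ | _     = zero
  ... | no _  | yes _ = suc zero
  ... | no _  | no _  = suc (suc zero)

  inner≢hub : ∀ {x} → x ∈ I → x ≢ v
  inner≢hub x∈I refl = v∉I x∈I

  level-hub : level v ≡ zero
  level-hub with v ≟ v
  ... | yes _ = refl
  ... | no v≢v = contradiction refl v≢v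

  level-inner : ∀ {x} → x ∈ I → level x ≡ suc zero
  level-inner {x} x∈I with x ≟ v | x ∈? I
  ... | yes x≡v | _ = contradiction x≡v (inner≢hub x∈I)
  ... | no _ | yes _ = refl
  ... | no _ | no x∉I = contradiction x∈I x∉I

  level-outer : ∀ {x} → x ≢ v → x ∉ I → level x ≡ suc (suc zero)
  level-outer {x} x≢v x∉I with x ≟ v | x ∈? I
  ... | yes x≡v | _ = contradiction x≡v x≢v
  ... | no _ | yes x∈I = contradiction x∈I x∉I
  ... | no _ | no _ = refl

  open CyclicOrientation G level using (arc-up)
  open CyclicOrientation G level public using (orientation)

  hub→inner : ∀ {x} → x ∈ I → Arc orientation v x
  hub→inner x∈I =
    arc-up (edge-sym G (universal _ (inner≢hub x∈I)))
           (trans (level-inner x∈I) (cong next (sym level-hub)))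

  inner→outer : ∀ {x y} → x ∈ I → y ≢ v → y ∉ I → Edge G x y → Arc orientation x y
  inner→outer x∈I y≢v y∉I x—y =
    arc-up x—y (trans (level-outer y≢v y∉I) (cong next (sym (level-inner x∈I))))

  outer→hub : ∀ {y} → y ≢ v → y ∉ I → Arc orientation y v
  outer→hub y≢v y∉I =
    arc-up (universal _ y≢v) (trans level-hub (cong next (sym (level-outer y≢v y∉I))))

  triangleThrough : ∀ x → x ≢ v → Σ (Triangle (Arc orientation) v) (x ∈ᵗ_)
  triangleThrough x x≢v with x ∈? I
  ... | yes x∈I =
    let w , w≢v , x—w = neighbour x x≢v
        w∉I = λ w∈I → I-independent x w x∈I w∈I x—w
    in triangle (hub→inner x∈I) (inner→outer x∈I w≢v w∉I x—w) (outer→hub w≢v w∉I) ,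
       inj₂ (inj₁ refl)
  ... | no x∉I =
    let y , y∈I , x—y = I-maximal x x≢v x∉I
    in triangle (hub→inner y∈I) (inner→outer y∈I x≢v x∉I (edge-sym G x—y)) (outer→hub x≢v x∉I) ,
       inj₂ (inj₂ refl)

  triangleCover : ∀ {w} → w ≢ v → TriangleCover orientation v
  triangleCover {w} w≢v = record { triangleAt = triangleAt }
    where
    triangleAt : ∀ x → Σ (Triangle (Arc orientation) v) (x ∈ᵗ_)
    triangleAt x with x ≟ v
    ... | yes refl = proj₁ (triangleThrough w w≢v) , inj₁ refl
    ... | no x≢v = triangleThrough x x≢v

-- The isolated-triangle hypothesis is only needed to provide a second vertex.
lemma2p3 : ∀ {n} (G : Graph n) (D : Subset n) → Standard G D → ∣ D ∣ ≡ 1 →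
    Σ (Orientation G) λ O → Strong O × DiamLe O 4 × SDiamLe O 6
lemma2p3 G D (_ , bridgeless , _ , dominating , _ , isolatedTriangle) ∣D∣≡1
  with ∣p∣≡1⇒singleton D ∣D∣≡1
... | v , v∈D , only-v =
  orientation , diam⇒strong {O = orientation} diam , diam , cover⇒sdiam≤6 cover
  where
  universal : ∀ x → x ≢ v → Edge G x v
  universal x x≢v =
    let d , d∈D , x—d = dominating x (x≢v ∘ only-v x) in subst (Edge G x) (only-v d d∈D) x—d

  neighbour : ∀ x → x ≢ v → ∃ λ w → w ≢ v × Edge G x w
  neighbour x x≢v = bridgeless⇒other-neighbour {G = G} bridgeless (universal x x≢v)

  open UniversalVertex G v universal neighbour

  v₁≢v : proj₁ (isolatedTriangle v v∈D) ≢ v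
  v₁≢v = let _ , _ , _ , _ , v—v₁ , _ = isolatedTriangle v v∈D in edge⇒≢ G v—v₁ ∘ sym

  cover : TriangleCover orientation v
  cover = triangleCover v₁≢v

  diam : DiamLe orientation 4
  diam = cover⇒diam≤4 cover
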